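{- Let $S\subset\mathbb{F}_2^n$ be nonempty. If $S$ is fully balanced, i.e. $B(S)\cup C(S)=\mathbb{F}_2^n$, then $S$ is either a vector subspace or an affine subspace of $\mathbb{F}_2^n$.
   Context: For $\mathbf{x},\mathbf{y}\in\mathbb{F}_2^n$ the pairing is $\mathbf{x}\cdot\mathbf{y}=\sum_{i=1}^n x_iy_i\in\mathbb{F}_2$, and $H_{\mathbf{y}}=\{\mathbf{x}\in\mathbb{F}_2^n\mid \mathbf{x}\cdot\mathbf{y}=0\}$. For a nonzero $\mathbf{y}$, a set $S$ is $\mathbf{y}$-balanced if $\#(S\cap H_{\mathbf{y}})=\#S/2$. $S$ is $\mathbf{y}$-constant if $S\subset H_{\mathbf{y}}$ or $S\cap H_{\mathbf{y}}=\emptyset$. The balancing set $B(S)$ is the set of nonzero $\mathbf{y}$ such that $S$ is $\mathbf{y}$-balanced; the constant set $C(S)$ is the set of $\mathbf{y}\in\mathbb{F}_2^n$ such that $S$ is $\mathbf{y}$-constant. -}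

module Defs where

open import Data.Bool using (Bool; true; false; _xor_; _∧_; not; if_then_else_)
open import Data.Nat using (ℕ; zero; suc; _+_; _*_)
open import Data.Vec using (Vec; []; _∷_; zipWith; replicate; foldr)
open import Data.List using (List; []; _∷_; map; _++_; length; filter)
open import Data.Product using (Σ; _×_; _,_)
open import Data.Sum using (_⊎_)
open import Relation.Binary.PropositionalEquality using (_≡_; _≢_)
open import Relation.Nullary using (¬_)

-- F₂ is modelled by Bool (false = 0, true = 1, addition = xor, multiplication = ∧).
F2^ : ℕ → Set
F2^ n = Vec Bool n

_⊕_ : ∀ {n} → F2^ n → F2^ n → F2^ n
_⊕_ = zipWith _xor_

𝟎 : ∀ {n} → F2^ n
𝟎 = replicate _ false

_·_ : ∀ {n} → F2^ n → F2^ n → Bool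
x · y = foldr _ _xor_ false (zipWith _∧_ x y)

allVecs : (n : ℕ) → List (F2^ n)
allVecs zero = [] ∷ []
allVecs (suc n) = map (false ∷_) (allVecs n) ++ map (true ∷_) (allVecs n)

Subset2 : ℕ → Set
Subset2 n = F2^ n → Bool

_∈S_ : ∀ {n} → F2^ n → Subset2 n → Set
x ∈S S = S x ≡ true

card : ∀ {n} → Subset2 n → ℕ
card {n} S = length (filter (λ x → S x Data.Bool.≟ true) (allVecs n))
  where import Data.Bool

inH : ∀ {n} → F2^ n → F2^ n → Bool
inH y x = not (x · y)

_∩H_ : ∀ {n} → Subset2 n → F2^ n → Subset2 n
(S ∩H y) x = S x ∧ inH y x

Nonempty : ∀ {n} → Subset2 n → Set
Nonempty {n} S = Σ (F2^ n) λ x → x ∈S S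

-- S is y-balanced: #(S ∩ H_y) = #S / 2  (stated without division: 2·#(S∩H_y) = #S)
Balanced : ∀ {n} → F2^ n → Subset2 n → Set
Balanced y S = 2 * card (S ∩H y) ≡ card S

Constant : ∀ {n} → F2^ n → Subset2 n → Set
Constant y S = (∀ x → x ∈S S → inH y x ≡ true) ⊎ (∀ x → x ∈S S → inH y x ≡ false)

InB : ∀ {n} → Subset2 n → F2^ n → Set
InB S y = (y ≢ 𝟎) × Balanced y S

InC : ∀ {n} → Subset2 n → F2^ n → Set
InC S y = Constant y S

FullyBalanced : ∀ {n} → Subset2 n → Set
FullyBalanced {n} S = ∀ (y : F2^ n) → InB S y ⊎ InC S y

-- vector subspace of F₂ⁿ: contains 0 and closed under addition
-- (over F₂ closure under scalar multiplication is automatic)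
IsSubspace : ∀ {n} → Subset2 n → Set
IsSubspace S = (𝟎 ∈S S) × (∀ x y → x ∈S S → y ∈S S → (x ⊕ y) ∈S S)

IsAffineSubspace : ∀ {n} → Subset2 n → Set
IsAffineSubspace {n} S =
  Σ (F2^ n) λ a → Σ (Subset2 n) λ V → IsSubspace V × (∀ x → S x ≡ V (a ⊕ x))

-- Translate S so that it contains 0, giving T.  Full balance says that every hyperplane
-- H_y either contains T or bisects it.  Counting the pairs (x, y) with x ∈ T ∩ H_y in two
-- ways then gives #T · #T⊥ = 2ⁿ.  The subspace T⊥ has the same dichotomy (a vector of
-- T⊥ off H_z swaps T⊥ ∩ H_z with T⊥ ∖ H_z), so also #T⊥ · #T⊥⊥ = 2ⁿ.  Hence T ⊆ T⊥⊥ have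
-- the same size, T = T⊥⊥ is a subspace, and S is its translate.
module Submission where

open import Defs
open import Algebra.Bundles using (CommutativeRing)
open import Data.Bool using (Bool; true; false; _xor_; _∧_; not; _≟_)
open import Data.Bool.Properties
  using (∧-comm; ∧-distribʳ-xor; xor-identityʳ; not-involutive; not-injective; ⇔→≡;
         xor-∧-commutativeRing)
open import Algebra.Properties.CommutativeSemigroup
  (CommutativeRing.+-commutativeSemigroup xor-∧-commutativeRing)
  using () renaming (interchange to xor-interchange)
open import Data.Nat using (ℕ; zero; suc; _+_; _*_; _^_; NonZero)
open import Data.Nat.Properties
  using (+-comm; +-identityʳ; +-cancelˡ-≡; *-cancelˡ-≡; *-comm; *-assoc; *-identityʳ;
         *-distribˡ-+; *-distribʳ-+; m+n≡0⇒m≡0; m+n≡0⇒n≡0; m^n≢0; m*n≢0⇒m≢0;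
         +-commutativeSemigroup)
open import Algebra.Properties.CommutativeSemigroup +-commutativeSemigroup
  using () renaming (interchange to +-interchange)
open import Data.Nat.Tactic.RingSolver using (solve-∀)
open import Data.Nat.ListAction using (sum)
open import Data.Nat.ListAction.Properties using (sum-++)
open import Data.List using (List; []; _∷_; _++_; map; filter; length)
open import Data.List.Properties using (map-++; map-∘)
open import Data.Vec using ([]; _∷_)
open import Data.Vec.Properties using (zipWith-identityʳ)
open import Data.Product using (Σ-syntax; _×_; _,_; proj₁)
open import Data.Sum using (_⊎_; inj₁; inj₂)
open import Function using (_∘_; mk⇔)
open import Relation.Binary.PropositionalEquality
open ≡-Reasoning

⟦_⟧ : Bool → ℕ
⟦ false ⟧ = 0
⟦ true ⟧ = 1

⟦∧⟧ : ∀ a b → ⟦ a ∧ b ⟧ ≡ ⟦ a ⟧ * ⟦ b ⟧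
⟦∧⟧ false b = refl
⟦∧⟧ true b = sym (+-identityʳ ⟦ b ⟧)

⟦⟧+⟦not⟧ : ∀ b → ⟦ b ⟧ + ⟦ not b ⟧ ≡ 1
⟦⟧+⟦not⟧ false = refl
⟦⟧+⟦not⟧ true = refl

∑ : ∀ {n} → (F2^ n → ℕ) → ℕ
∑ {zero} f = f []
∑ {suc n} f = ∑ (f ∘ (false ∷_)) + ∑ (f ∘ (true ∷_))

∑-cong : ∀ {n} {f g : F2^ n → ℕ} → (∀ x → f x ≡ g x) → ∑ f ≡ ∑ g
∑-cong {zero} f≗g = f≗g []
∑-cong {suc n} f≗g = cong₂ _+_ (∑-cong (f≗g ∘ (false ∷_))) (∑-cong (f≗g ∘ (true ∷_)))

∑-+ : ∀ {n} (f g : F2^ n → ℕ) → ∑ (λ x → f x + g x) ≡ ∑ f + ∑ g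
∑-+ {zero} f g = refl
∑-+ {suc n} f g = begin
  ∑ (λ x → f₀ x + g₀ x) + ∑ (λ x → f₁ x + g₁ x) ≡⟨ cong₂ _+_ (∑-+ f₀ g₀) (∑-+ f₁ g₁) ⟩
  (∑ f₀ + ∑ g₀) + (∑ f₁ + ∑ g₁)                 ≡⟨ +-interchange (∑ f₀) (∑ g₀) (∑ f₁) (∑ g₁) ⟩
  (∑ f₀ + ∑ f₁) + (∑ g₀ + ∑ g₁)                 ∎
  where
  f₀ = f ∘ (false ∷_); f₁ = f ∘ (true ∷_)
  g₀ = g ∘ (false ∷_); g₁ = g ∘ (true ∷_)

∑-*ˡ : ∀ {n} c (f : F2^ n → ℕ) → ∑ (λ x → c * f x) ≡ c * ∑ f
∑-*ˡ {zero} c f = refl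
∑-*ˡ {suc n} c f = trans (cong₂ _+_ (∑-*ˡ c (f ∘ (false ∷_))) (∑-*ˡ c (f ∘ (true ∷_))))
                         (sym (*-distribˡ-+ c _ _))

∑-*ʳ : ∀ {n} c (f : F2^ n → ℕ) → ∑ (λ x → f x * c) ≡ ∑ f * c
∑-*ʳ c f = begin
  ∑ (λ x → f x * c) ≡⟨ ∑-cong (λ x → *-comm (f x) c) ⟩
  ∑ (λ x → c * f x) ≡⟨ ∑-*ˡ c f ⟩
  c * ∑ f           ≡⟨ *-comm c (∑ f) ⟩
  ∑ f * c           ∎

∑-const : ∀ {n} k → ∑ {n} (λ _ → k) ≡ 2 ^ n * k
∑-const {zero} k = sym (+-identityʳ k)
∑-const {suc n} k = begin
  ∑ {n} (λ _ → k) + ∑ {n} (λ _ → k) ≡⟨ cong₂ _+_ (∑-const {n} k) (∑-const {n} k) ⟩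
  p * k + p * k                     ≡⟨ cong (p * k +_) (sym (+-identityʳ (p * k))) ⟩
  2 * (p * k)                       ≡⟨ sym (*-assoc 2 p k) ⟩
  2 * p * k                         ∎
  where p = 2 ^ n

∑-swap : ∀ {n m} (g : F2^ n → F2^ m → ℕ) → ∑ (λ x → ∑ (g x)) ≡ ∑ (λ y → ∑ (λ x → g x y))
∑-swap {zero} g = refl
∑-swap {suc n} {m} g = trans (cong₂ _+_ (∑-swap (g ∘ (false ∷_))) (∑-swap (g ∘ (true ∷_))))
                         (sym (∑-+ {m} _ _))

∑-translate : ∀ {n} (a : F2^ n) (f : F2^ n → ℕ) → ∑ (λ x → f (a ⊕ x)) ≡ ∑ f
∑-translate [] f = refl
∑-translate (false ∷ a) f =
  cong₂ _+_ (∑-translate a (f ∘ (false ∷_))) (∑-translate a (f ∘ (true ∷_)))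
∑-translate (true ∷ a) f =
  trans (cong₂ _+_ (∑-translate a (f ∘ (true ∷_))) (∑-translate a (f ∘ (false ∷_))))
        (+-comm (∑ (f ∘ (true ∷_))) (∑ (f ∘ (false ∷_))))

is𝟎 : ∀ {n} → F2^ n → Bool
is𝟎 [] = true
is𝟎 (b ∷ x) = not b ∧ is𝟎 x

∑-δ𝟎 : ∀ {n} (f : F2^ n → ℕ) → ∑ (λ x → ⟦ is𝟎 x ⟧ * f x) ≡ f 𝟎
∑-δ𝟎 {zero} f = +-identityʳ (f [])
∑-δ𝟎 {suc n} f = trans (cong₂ _+_ (∑-δ𝟎 (f ∘ (false ∷_))) (∑-*ˡ 0 (f ∘ (true ∷_))))
                       (+-identityʳ (f 𝟎))

∑≡0⇒≡0 : ∀ {n} (f : F2^ n → ℕ) → ∑ f ≡ 0 → ∀ x → f x ≡ 0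
∑≡0⇒≡0 {zero} f ∑f≡0 [] = ∑f≡0
∑≡0⇒≡0 {suc n} f ∑f≡0 (false ∷ x) = ∑≡0⇒≡0 (f ∘ (false ∷_)) (m+n≡0⇒m≡0 _ ∑f≡0) x
∑≡0⇒≡0 {suc n} f ∑f≡0 (true ∷ x) = ∑≡0⇒≡0 (f ∘ (true ∷_)) (m+n≡0⇒n≡0 _ ∑f≡0) x

# : ∀ {n} → Subset2 n → ℕ
# S = ∑ (⟦_⟧ ∘ S)

length-filter≡sum : ∀ {n} (S : Subset2 n) (xs : List (F2^ n)) →
  length (filter (λ x → S x ≟ true) xs) ≡ sum (map (⟦_⟧ ∘ S) xs)
length-filter≡sum S [] = refl
length-filter≡sum S (x ∷ xs) with S x
... | true = cong suc (length-filter≡sum S xs)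
... | false = length-filter≡sum S xs

sum-allVecs : ∀ n (f : F2^ n → ℕ) → sum (map f (allVecs n)) ≡ ∑ f
sum-allVecs zero f = +-identityʳ (f [])
sum-allVecs (suc n) f = begin
  sum (map f (map (false ∷_) xs ++ map (true ∷_) xs))
    ≡⟨ cong sum (map-++ f (map (false ∷_) xs) _) ⟩
  sum (map f (map (false ∷_) xs) ++ map f (map (true ∷_) xs))
    ≡⟨ sum-++ (map f (map (false ∷_) xs)) _ ⟩
  sum (map f (map (false ∷_) xs)) + sum (map f (map (true ∷_) xs))
    ≡⟨ cong₂ _+_ (cong sum (sym (map-∘ xs))) (cong sum (sym (map-∘ xs))) ⟩
  sum (map (f ∘ (false ∷_)) xs) + sum (map (f ∘ (true ∷_)) xs)
    ≡⟨ cong₂ _+_ (sum-allVecs n _) (sum-allVecs n _) ⟩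
  ∑ (f ∘ (false ∷_)) + ∑ (f ∘ (true ∷_)) ∎
  where xs = allVecs n

card≡# : ∀ {n} (S : Subset2 n) → card S ≡ # S
card≡# {n} S = trans (length-filter≡sum S (allVecs n)) (sum-allVecs n _)

⊆∧#≡⇒≗ : ∀ {n} (A B : Subset2 n) → (∀ x → x ∈S A → x ∈S B) → # A ≡ # B → ∀ x → A x ≡ B x
⊆∧#≡⇒≗ A B A⊆B #A≡#B x = pointwise (A x) (B x) (A⊆B x) (∑≡0⇒≡0 _ #B∖A≡0 x)
  where
  split : ∀ a b → (a ≡ true → b ≡ true) → ⟦ b ⟧ ≡ ⟦ a ⟧ + ⟦ not a ∧ b ⟧
  split false b _ = refl
  split true b a⇒b rewrite a⇒b refl = refl
  #B∖A≡0 : ∑ (λ x → ⟦ not (A x) ∧ B x ⟧) ≡ 0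
  #B∖A≡0 = +-cancelˡ-≡ (# A) _ 0 (begin
    # A + ∑ (λ x → ⟦ not (A x) ∧ B x ⟧) ≡⟨ sym (∑-+ (⟦_⟧ ∘ A) _) ⟩
    ∑ (λ x → ⟦ A x ⟧ + ⟦ not (A x) ∧ B x ⟧) ≡⟨ ∑-cong (λ y → sym (split (A y) (B y) (A⊆B y))) ⟩
    # B ≡⟨ sym #A≡#B ⟩
    # A ≡⟨ sym (+-identityʳ (# A)) ⟩
    # A + 0 ∎)
  pointwise : ∀ a b → (a ≡ true → b ≡ true) → ⟦ not a ∧ b ⟧ ≡ 0 → a ≡ b
  pointwise false false _ _ = refl
  pointwise false true _ ()
  pointwise true b a⇒b _ = sym (a⇒b refl)

⊕-identityʳ : ∀ {n} (a : F2^ n) → a ⊕ 𝟎 ≡ a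
⊕-identityʳ = zipWith-identityʳ xor-identityʳ

⊕-cancelˡ : ∀ {n} (a x : F2^ n) → a ⊕ (a ⊕ x) ≡ x
⊕-cancelˡ [] [] = refl
⊕-cancelˡ (false ∷ a) (x ∷ xs) = cong (x ∷_) (⊕-cancelˡ a xs)
⊕-cancelˡ (true ∷ a) (x ∷ xs) = cong₂ _∷_ (not-involutive x) (⊕-cancelˡ a xs)

·-comm : ∀ {n} (x y : F2^ n) → x · y ≡ y · x
·-comm [] [] = refl
·-comm (a ∷ x) (b ∷ y) = cong₂ _xor_ (∧-comm a b) (·-comm x y)

·-zeroˡ : ∀ {n} (y : F2^ n) → 𝟎 · y ≡ false
·-zeroˡ [] = refl
·-zeroˡ (_ ∷ y) = ·-zeroˡ y

·-zeroʳ : ∀ {n} (x : F2^ n) → x · 𝟎 ≡ false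
·-zeroʳ x = trans (·-comm x 𝟎) (·-zeroˡ x)

·-distribʳ-⊕ : ∀ {n} (a x y : F2^ n) → (a ⊕ x) · y ≡ (a · y) xor (x · y)
·-distribʳ-⊕ [] [] [] = refl
·-distribʳ-⊕ (a ∷ as) (x ∷ xs) (y ∷ ys) = begin
  ((a xor x) ∧ y) xor ((as ⊕ xs) · ys)
    ≡⟨ cong₂ _xor_ (∧-distribʳ-xor y a x) (·-distribʳ-⊕ as xs ys) ⟩
  ((a ∧ y) xor (x ∧ y)) xor ((as · ys) xor (xs · ys))
    ≡⟨ xor-interchange (a ∧ y) (x ∧ y) (as · ys) (xs · ys) ⟩
  ((a ∧ y) xor (as · ys)) xor ((x ∧ y) xor (xs · ys)) ∎

-- #H_x is 2ⁿ for x = 0 and 2ⁿ⁻¹ otherwise; doubling avoids the exponent n ∸ 1.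
#H : ∀ {n} (x : F2^ n) → 2 * # (inH x) ≡ (1 + ⟦ is𝟎 x ⟧) * 2 ^ n
#H [] = refl
#H {suc n} (false ∷ x) = begin
  2 * (h + h)     ≡⟨ *-distribˡ-+ 2 h h ⟩
  2 * h + 2 * h   ≡⟨ cong₂ _+_ (#H x) (#H x) ⟩
  c * p + c * p   ≡⟨ double c p ⟩
  c * (2 * p)     ∎
  where
  h = # (inH x); p = 2 ^ n; c = 1 + ⟦ is𝟎 x ⟧
  double : ∀ c p → c * p + c * p ≡ c * (2 * p)
  double = solve-∀
#H {suc n} (true ∷ x) = begin
  2 * (∑ (λ y → ⟦ not (y · x) ⟧) + ∑ (λ y → ⟦ not (not (y · x)) ⟧))
    ≡⟨ cong (2 *_) (sym (∑-+ {n} _ _)) ⟩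
  2 * ∑ (λ y → ⟦ not (y · x) ⟧ + ⟦ not (not (y · x)) ⟧)
    ≡⟨ cong (2 *_) (∑-cong (λ y → ⟦⟧+⟦not⟧ (not (y · x)))) ⟩
  2 * ∑ {n} (λ _ → 1) ≡⟨ cong (2 *_) (trans (∑-const {n} 1) (*-identityʳ (2 ^ n))) ⟩
  2 * 2 ^ n           ≡⟨ sym (+-identityʳ (2 * 2 ^ n)) ⟩
  2 * 2 ^ n + 0       ∎

every : ∀ {n} → (F2^ n → Bool) → Bool
every {zero} P = P []
every {suc n} P = every (P ∘ (false ∷_)) ∧ every (P ∘ (true ∷_))

every-intro : ∀ {n} (P : F2^ n → Bool) → (∀ x → P x ≡ true) → every P ≡ true
every-intro {zero} P ∀P = ∀P []
every-intro {suc n} P ∀P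
  rewrite every-intro (P ∘ (false ∷_)) (∀P ∘ (false ∷_))
        | every-intro (P ∘ (true ∷_)) (∀P ∘ (true ∷_)) = refl

every-elim : ∀ {n} (P : F2^ n → Bool) → every P ≡ true → ∀ x → P x ≡ true
every-elim {zero} P ∀P [] = ∀P
every-elim {suc n} P ∀P (b ∷ x) with every (P ∘ (false ∷_)) in ∀P₀ | b
... | true | false = every-elim (P ∘ (false ∷_)) ∀P₀ x
... | true | true = every-elim (P ∘ (true ∷_)) ∀P x

every-counterexample : ∀ {n} (P : F2^ n → Bool) → every P ≡ false → Σ[ x ∈ F2^ n ] P x ≡ false
every-counterexample {zero} P ¬∀P = [] , ¬∀P
every-counterexample {suc n} P ¬∀P with every (P ∘ (false ∷_)) in ∀P₀
... | false = let x , Px≡false = every-counterexample (P ∘ (false ∷_)) ∀P₀ in false ∷ x , Px≡false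
... | true = let x , Px≡false = every-counterexample (P ∘ (true ∷_)) ¬∀P in true ∷ x , Px≡false

Orthogonal : ∀ {n} → F2^ n → Subset2 n → Set
Orthogonal y S = ∀ x → x ∈S S → x · y ≡ false

infixl 30 _^⊥
_^⊥ : ∀ {n} → Subset2 n → Subset2 n
(S ^⊥) y = every (λ x → not (S x ∧ x · y))

^⊥-intro : ∀ {n} (S : Subset2 n) y → Orthogonal y S → y ∈S S ^⊥
^⊥-intro S y y⊥S = every-intro _ (λ x → not-∧-intro (S x) (x · y) (y⊥S x))
  where
  not-∧-intro : ∀ s p → (s ≡ true → p ≡ false) → not (s ∧ p) ≡ true
  not-∧-intro false p _ = refl
  not-∧-intro true p s⇒¬p rewrite s⇒¬p refl = refl

^⊥-elim : ∀ {n} (S : Subset2 n) y → y ∈S S ^⊥ → Orthogonal y S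
^⊥-elim S y y∈S⊥ x x∈S = not-∧-elim (S x) (x · y) (every-elim _ y∈S⊥ x) x∈S
  where
  not-∧-elim : ∀ s p → not (s ∧ p) ≡ true → s ≡ true → p ≡ false
  not-∧-elim true false _ _ = refl

^⊥-counterexample : ∀ {n} (S : Subset2 n) y → (S ^⊥) y ≡ false →
  Σ[ x ∈ F2^ n ] (x ∈S S × x · y ≡ true)
^⊥-counterexample S y y∉S⊥ =
  let x , ¬x⊥y = every-counterexample _ y∉S⊥ in x , not-∧≡false (S x) (x · y) ¬x⊥y
  where
  not-∧≡false : ∀ s p → not (s ∧ p) ≡ false → s ≡ true × p ≡ true
  not-∧≡false true true _ = refl , refl

^⊥-isSubspace : ∀ {n} (S : Subset2 n) → IsSubspace (S ^⊥)
^⊥-isSubspace S =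
  ^⊥-intro S 𝟎 (λ x _ → ·-zeroʳ x) ,
  λ y y' y∈S⊥ y'∈S⊥ → ^⊥-intro S (y ⊕ y') λ x x∈S → begin
    x · (y ⊕ y')            ≡⟨ ·-comm x (y ⊕ y') ⟩
    (y ⊕ y') · x            ≡⟨ ·-distribʳ-⊕ y y' x ⟩
    (y · x) xor (y' · x)    ≡⟨ cong₂ _xor_ (orth y y∈S⊥ x x∈S) (orth y' y'∈S⊥ x x∈S) ⟩
    false                   ∎
  where
  orth : ∀ y → y ∈S S ^⊥ → ∀ x → x ∈S S → y · x ≡ false
  orth y y∈S⊥ x x∈S = trans (·-comm y x) (^⊥-elim S y y∈S⊥ x x∈S)

⊆^⊥^⊥ : ∀ {n} (S : Subset2 n) x → x ∈S S → x ∈S S ^⊥ ^⊥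
⊆^⊥^⊥ S x x∈S = ^⊥-intro (S ^⊥) x λ y y∈S⊥ → trans (·-comm y x) (^⊥-elim S y y∈S⊥ x x∈S)

translate : ∀ {n} → F2^ n → Subset2 n → Subset2 n
translate a S x = S (a ⊕ x)

_∖H_ : ∀ {n} → Subset2 n → F2^ n → Subset2 n
(S ∖H y) x = S x ∧ x · y

Bisects : ∀ {n} → F2^ n → Subset2 n → Set
Bisects y S = 2 * # (S ∩H y) ≡ # S

OrthogonalOrBisected : ∀ {n} → Subset2 n → Set
OrthogonalOrBisected {n} S = ∀ (y : F2^ n) → Orthogonal y S ⊎ Bisects y S

#∩H+#∖H : ∀ {n} (S : Subset2 n) y → # (S ∩H y) + # (S ∖H y) ≡ # S
#∩H+#∖H {n} S y = trans (sym (∑-+ {n} _ _)) (∑-cong λ x → split (S x) (x · y))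
  where
  split : ∀ s p → ⟦ s ∧ not p ⟧ + ⟦ s ∧ p ⟧ ≡ ⟦ s ⟧
  split false p = refl
  split true p = trans (+-comm ⟦ not p ⟧ ⟦ p ⟧) (⟦⟧+⟦not⟧ p)

#∩H≡#∖H⇒bisects : ∀ {n} (S : Subset2 n) y → # (S ∩H y) ≡ # (S ∖H y) → Bisects y S
#∩H≡#∖H⇒bisects S y #∩H≡#∖H = begin
  2 * # (S ∩H y)          ≡⟨ cong (# (S ∩H y) +_) (+-identityʳ _) ⟩
  # (S ∩H y) + # (S ∩H y) ≡⟨ cong (# (S ∩H y) +_) #∩H≡#∖H ⟩
  # (S ∩H y) + # (S ∖H y) ≡⟨ #∩H+#∖H S y ⟩
  # S                     ∎

bisects⇒#∖H≡#∩H : ∀ {n} (S : Subset2 n) y → Bisects y S → # (S ∖H y) ≡ # (S ∩H y)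
bisects⇒#∖H≡#∩H S y bisects = +-cancelˡ-≡ (# (S ∩H y)) _ _ (begin
  # (S ∩H y) + # (S ∖H y) ≡⟨ #∩H+#∖H S y ⟩
  # S                     ≡⟨ sym bisects ⟩
  2 * # (S ∩H y)          ≡⟨ cong (# (S ∩H y) +_) (+-identityʳ _) ⟩
  # (S ∩H y) + # (S ∩H y) ∎)

balanced⇒bisects : ∀ {n} (S : Subset2 n) y → Balanced y S → Bisects y S
balanced⇒bisects S y balanced =
  trans (cong (2 *_) (sym (card≡# (S ∩H y)))) (trans balanced (card≡# S))

orthogonal⇒#∩H≡# : ∀ {n} (S : Subset2 n) y → Orthogonal y S → # (S ∩H y) ≡ # S
orthogonal⇒#∩H≡# S y y⊥S = ∑-cong λ x → pointwise (S x) (x · y) (y⊥S x)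
  where
  pointwise : ∀ s p → (s ≡ true → p ≡ false) → ⟦ s ∧ not p ⟧ ≡ ⟦ s ⟧
  pointwise false p _ = refl
  pointwise true p s⇒¬p rewrite s⇒¬p refl = refl

#-translate : ∀ {n} a (S : Subset2 n) → # (translate a S) ≡ # S
#-translate a S = ∑-translate a (⟦_⟧ ∘ S)

#∩H-translate : ∀ {n} a (S : Subset2 n) y →
  # (translate a S ∩H y) ≡ ∑ (λ x → ⟦ S x ∧ not ((a · y) xor (x · y)) ⟧)
#∩H-translate a S y = begin
  ∑ (λ x → ⟦ S (a ⊕ x) ∧ not (x · y) ⟧)
    ≡⟨ sym (∑-translate a _) ⟩
  ∑ (λ x → ⟦ S (a ⊕ (a ⊕ x)) ∧ not ((a ⊕ x) · y) ⟧)
    ≡⟨ ∑-cong (λ x → cong₂ (λ u v → ⟦ S u ∧ not v ⟧) (⊕-cancelˡ a x) (·-distribʳ-⊕ a x y)) ⟩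
  ∑ (λ x → ⟦ S x ∧ not ((a · y) xor (x · y)) ⟧) ∎

#∩H-translate-even : ∀ {n} a (S : Subset2 n) y → a · y ≡ false →
  # (translate a S ∩H y) ≡ # (S ∩H y)
#∩H-translate-even a S y a·y≡false rewrite #∩H-translate a S y | a·y≡false = refl

#∩H-translate-odd : ∀ {n} a (S : Subset2 n) y → a · y ≡ true →
  # (translate a S ∩H y) ≡ # (S ∖H y)
#∩H-translate-odd a S y a·y≡true rewrite #∩H-translate a S y | a·y≡true =
  ∑-cong λ x → cong (λ p → ⟦ S x ∧ p ⟧) (not-involutive (x · y))

bisects-translate : ∀ {n} a (S : Subset2 n) y → Bisects y S → Bisects y (translate a S)
bisects-translate a S y bisects with a · y in a·y
... | false = begin
  2 * # (translate a S ∩H y) ≡⟨ cong (2 *_) (#∩H-translate-even a S y a·y) ⟩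
  2 * # (S ∩H y)             ≡⟨ bisects ⟩
  # S                        ≡⟨ sym (#-translate a S) ⟩
  # (translate a S)          ∎
... | true = begin
  2 * # (translate a S ∩H y) ≡⟨ cong (2 *_) (#∩H-translate-odd a S y a·y) ⟩
  2 * # (S ∖H y)             ≡⟨ cong (2 *_) (bisects⇒#∖H≡#∩H S y bisects) ⟩
  2 * # (S ∩H y)             ≡⟨ bisects ⟩
  # S                        ≡⟨ sym (#-translate a S) ⟩
  # (translate a S)          ∎

constant⇒orthogonal-translate : ∀ {n} (S : Subset2 n) a y → a ∈S S → Constant y S →
  Orthogonal y (translate a S)
constant⇒orthogonal-translate S a y a∈S constant x a⊕x∈S =
  xor-≡ˡ⇒≡false (a · y) (x · y) (begin
    (a · y) xor (x · y) ≡⟨ sym (·-distribʳ-⊕ a x y) ⟩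
    (a ⊕ x) · y         ≡⟨ not-injective (sameSide constant) ⟩
    a · y               ∎)
  where
  sameSide : Constant y S → inH y (a ⊕ x) ≡ inH y a
  sameSide (inj₁ S⊆H) = trans (S⊆H (a ⊕ x) a⊕x∈S) (sym (S⊆H a a∈S))
  sameSide (inj₂ S∩H≡∅) = trans (S∩H≡∅ (a ⊕ x) a⊕x∈S) (sym (S∩H≡∅ a a∈S))
  xor-≡ˡ⇒≡false : ∀ p q → p xor q ≡ p → q ≡ false
  xor-≡ˡ⇒≡false false q q≡false = q≡false
  xor-≡ˡ⇒≡false true false _ = refl

fullyBalanced⇒orthogonalOrBisected : ∀ {n} (S : Subset2 n) a → a ∈S S → FullyBalanced S →
  OrthogonalOrBisected (translate a S)
fullyBalanced⇒orthogonalOrBisected S a a∈S fullyBalanced y with fullyBalanced y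
... | inj₁ (_ , balanced) = inj₂ (bisects-translate a S y (balanced⇒bisects S y balanced))
... | inj₂ constant = inj₁ (constant⇒orthogonal-translate S a y a∈S constant)

translate-subspace : ∀ {n} (V : Subset2 n) a → IsSubspace V → a ∈S V →
  ∀ x → translate a V x ≡ V x
translate-subspace V a (_ , closed) a∈V x = ⇔→≡ (mk⇔
  (λ a⊕x∈V → subst (_∈S V) (⊕-cancelˡ a x) (closed a (a ⊕ x) a∈V a⊕x∈V))
  (λ x∈V → closed a x a∈V x∈V))

-- A vector of V off the hyperplane H_z swaps V ∩ H_z with V ∖ H_z.
subspace⇒orthogonalOrBisected : ∀ {n} (V : Subset2 n) → IsSubspace V → OrthogonalOrBisected V
subspace⇒orthogonalOrBisected V isSubspace z with (V ^⊥) z in z∈V⊥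
... | true = inj₁ (^⊥-elim V z z∈V⊥)
... | false = let y , y∈V , y·z≡true = ^⊥-counterexample V z z∈V⊥ in
  inj₂ (#∩H≡#∖H⇒bisects V z (begin
    # (V ∩H z)             ≡⟨ ∑-cong (λ x → cong (λ v → ⟦ v ∧ not (x · z) ⟧)
                                          (sym (translate-subspace V y isSubspace y∈V x))) ⟩
    # (translate y V ∩H z) ≡⟨ #∩H-translate-odd y V z y·z≡true ⟩
    # (V ∖H z)             ∎))

-- Double counting the pairs (x, y) with x ∈ A ∩ H_y

∑#∩H : ∀ {n} (A : Subset2 n) → 2 * ∑ (λ y → # (A ∩H y)) ≡ (# A + ⟦ A 𝟎 ⟧) * 2 ^ n
∑#∩H {n} A = begin
  2 * ∑ (λ y → ∑ (λ x → ⟦ A x ∧ not (x · y) ⟧))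
    ≡⟨ cong (2 *_) (∑-swap (λ y x → ⟦ A x ∧ not (x · y) ⟧)) ⟩
  2 * ∑ (λ x → ∑ (λ y → ⟦ A x ∧ not (x · y) ⟧))
    ≡⟨ cong (2 *_) (∑-cong λ x → trans (∑-cong (λ y → ⟦∧⟧ (A x) (not (x · y))))
                                        (∑-*ˡ ⟦ A x ⟧ (λ y → ⟦ not (x · y) ⟧))) ⟩
  2 * ∑ (λ x → ⟦ A x ⟧ * ∑ (λ y → ⟦ not (x · y) ⟧))
    ≡⟨ sym (∑-*ˡ {n} 2 _) ⟩
  ∑ (λ x → 2 * (⟦ A x ⟧ * ∑ (λ y → ⟦ not (x · y) ⟧)))
    ≡⟨ ∑-cong (λ x → count x) ⟩
  ∑ (λ x → ⟦ A x ⟧ * p + ⟦ is𝟎 x ⟧ * (⟦ A x ⟧ * p))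
    ≡⟨ ∑-+ {n} _ _ ⟩
  ∑ (λ x → ⟦ A x ⟧ * p) + ∑ (λ x → ⟦ is𝟎 x ⟧ * (⟦ A x ⟧ * p))
    ≡⟨ cong₂ _+_ (∑-*ʳ p (⟦_⟧ ∘ A)) (∑-δ𝟎 (λ x → ⟦ A x ⟧ * p)) ⟩
  # A * p + ⟦ A 𝟎 ⟧ * p
    ≡⟨ sym (*-distribʳ-+ p (# A) ⟦ A 𝟎 ⟧) ⟩
  (# A + ⟦ A 𝟎 ⟧) * p ∎
  where
  p = 2 ^ n
  count : ∀ x → 2 * (⟦ A x ⟧ * ∑ (λ y → ⟦ not (x · y) ⟧)) ≡
                ⟦ A x ⟧ * p + ⟦ is𝟎 x ⟧ * (⟦ A x ⟧ * p)
  count x = begin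
    2 * (a * ∑ (λ y → ⟦ not (x · y) ⟧))
      ≡⟨ cong (λ h → 2 * (a * h)) (∑-cong λ y → cong (⟦_⟧ ∘ not) (·-comm x y)) ⟩
    2 * (a * h)                         ≡⟨ swap 2 a h ⟩
    a * (2 * h)                         ≡⟨ cong (a *_) (#H x) ⟩
    a * ((1 + z) * p)                   ≡⟨ expand a z p ⟩
    a * p + z * (a * p)                 ∎
    where
    a = ⟦ A x ⟧; h = # (inH x); z = ⟦ is𝟎 x ⟧
    swap : ∀ b a h → b * (a * h) ≡ a * (b * h)
    swap = solve-∀
    expand : ∀ a z p → a * ((1 + z) * p) ≡ a * p + z * (a * p)
    expand = solve-∀

twice-#∩H : ∀ {n} (A : Subset2 n) → OrthogonalOrBisected A →
  ∀ y → 2 * # (A ∩H y) ≡ # A + ⟦ (A ^⊥) y ⟧ * # A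
twice-#∩H A orthogonalOrBisected y with (A ^⊥) y in y∈A⊥ | orthogonalOrBisected y
... | true | _ = begin
  2 * # (A ∩H y) ≡⟨ cong (2 *_) (orthogonal⇒#∩H≡# A y (^⊥-elim A y y∈A⊥)) ⟩
  2 * # A        ∎
... | false | inj₂ bisects = trans bisects (sym (+-identityʳ (# A)))
... | false | inj₁ y⊥A with () ← trans (sym y∈A⊥) (^⊥-intro A y y⊥A)

#^⊥*#≡2^n : ∀ {n} (A : Subset2 n) → 𝟎 ∈S A → OrthogonalOrBisected A → # (A ^⊥) * # A ≡ 2 ^ n
#^⊥*#≡2^n {n} A 𝟎∈A orthogonalOrBisected = sym (+-cancelˡ-≡ (p * a) _ _ (begin
  p * a + p                                ≡⟨ rearrange p a ⟩
  (a + 1) * p                              ≡⟨ cong (λ b → (a + ⟦ b ⟧) * p) (sym 𝟎∈A) ⟩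
  (a + ⟦ A 𝟎 ⟧) * p                        ≡⟨ sym (∑#∩H A) ⟩
  2 * ∑ (λ y → # (A ∩H y))                 ≡⟨ sym (∑-*ˡ {n} 2 _) ⟩
  ∑ (λ y → 2 * # (A ∩H y))                 ≡⟨ ∑-cong (twice-#∩H A orthogonalOrBisected) ⟩
  ∑ (λ y → a + ⟦ (A ^⊥) y ⟧ * a)           ≡⟨ ∑-+ {n} _ _ ⟩
  ∑ {n} (λ _ → a) + ∑ (λ y → ⟦ (A ^⊥) y ⟧ * a) ≡⟨ cong₂ _+_ (∑-const {n} a) (∑-*ʳ a (⟦_⟧ ∘ A ^⊥)) ⟩
  p * a + # (A ^⊥) * a                     ∎))
  where
  p = 2 ^ n; a = # A
  rearrange : ∀ p a → p * a + p ≡ (a + 1) * p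
  rearrange = solve-∀

orthogonalOrBisected⇒≗^⊥^⊥ : ∀ {n} (A : Subset2 n) → 𝟎 ∈S A → OrthogonalOrBisected A → ∀ x → A x ≡ (A ^⊥ ^⊥) x
orthogonalOrBisected⇒≗^⊥^⊥ {n} A 𝟎∈A orthogonalOrBisected = ⊆∧#≡⇒≗ A (A ^⊥ ^⊥) (⊆^⊥^⊥ A) #A≡#A⊥⊥
  where
  A⊥ = A ^⊥
  counts : # A⊥ * # A ≡ # (A⊥ ^⊥) * # A⊥
  counts = trans (#^⊥*#≡2^n A 𝟎∈A orthogonalOrBisected)
                 (sym (#^⊥*#≡2^n A⊥ (proj₁ (^⊥-isSubspace A))
                                    (subspace⇒orthogonalOrBisected A⊥ (^⊥-isSubspace A))))
  instance
    #A⊥≢0 : NonZero (# A⊥)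
    #A⊥≢0 = m*n≢0⇒m≢0 (# A⊥) {{subst NonZero (sym (#^⊥*#≡2^n A 𝟎∈A orthogonalOrBisected))
                                                (m^n≢0 2 n)}}
  #A≡#A⊥⊥ : # A ≡ # (A⊥ ^⊥)
  #A≡#A⊥⊥ = *-cancelˡ-≡ (# A) _ (# A⊥) (trans counts (*-comm (# (A⊥ ^⊥)) (# A⊥)))

theorem3 : ∀ (n : ℕ) (S : Subset2 n) → Nonempty S → FullyBalanced S →
    IsSubspace S ⊎ IsAffineSubspace S
theorem3 n S (a , a∈S) fullyBalanced = inj₂ (a , T ^⊥ ^⊥ , ^⊥-isSubspace (T ^⊥) , S≗a+T⊥⊥)
  where
  T = translate a S
  T≗T⊥⊥ : ∀ x → T x ≡ (T ^⊥ ^⊥) x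
  T≗T⊥⊥ = orthogonalOrBisected⇒≗^⊥^⊥ T (trans (cong S (⊕-identityʳ a)) a∈S)
            (fullyBalanced⇒orthogonalOrBisected S a a∈S fullyBalanced)
  S≗a+T⊥⊥ : ∀ x → S x ≡ (T ^⊥ ^⊥) (a ⊕ x)
  S≗a+T⊥⊥ x = trans (cong S (sym (⊕-cancelˡ a x))) (T≗T⊥⊥ (a ⊕ x))
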